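{- For every $k\in\mathbb{N}$, the function $W_k:\mathbb{G}_k\to\mathbb{R}$, $$W_k(\sigma):=\frac{\xi_{k+1}(1,-1)(0,\sigma)}{\xi_{k+1}(1,1)(0,\sigma)},$$ is strictly ferromagnetic, i.e. $2^{ -k}\sum_{\sigma\in\mathbb{G}_k}(-1)^{\sigma\cdot\tau}W_k(\sigma)\ge0$ for all $\tau\in\mathbb{G}_k$.
   Context: For $k\in\mathbb{N}$ let $\mathbb{G}_k=(\mathbb{Z}/2\mathbb{Z})^k$ (elements $\sigma=(\sigma_1,\dots,\sigma_k)$, $\sigma_i\in\{0,1\}$), $\sigma\cdot\tau=\sum_i\sigma_i\tau_i$, and $1-\sigma:=(1-\sigma_1,\dots,1-\sigma_k)$. For $s_0,s_1\in\mathbb{R}$ define $\xi_k(s_0,s_1):\mathbb{G}_k\to\mathbb{R}$ by $\xi_1(s_0,s_1)(0)=s_0$, $\xi_1(s_0,s_1)(1)=s_1$, and $\xi_{k+1}(s_0,s_1)(\sigma,\sigma_{k+1})=\xi_k(s_0,s_1)(\sigma)+\sigma_{k+1}\xi_k(s_0,s_1)(1-\sigma)$. (The denominator $\xi_{k+1}(1,1)(0,\sigma)$ is a positive integer.) -}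

module Defs where

open import Data.Nat using (ℕ; zero; suc)
import Data.Nat as ℕ
open import Data.Bool using (Bool; true; false; not; _∧_; if_then_else_)
open import Data.Fin using (Fin; inject₁; fromℕ)
import Data.Fin as F
open import Data.Integer as ℤ using (ℤ; +_; -[1+_])
open import Data.Rational as ℚ using (ℚ; 0ℚ; 1ℚ; _/_)
open import Data.Vec.Functional using (_∷_)
open import Function using (_∘_)

-- 𝔾_k = (ℤ/2ℤ)^k, coordinates σ_1..σ_k as Fin k → Bool (false = 0, true = 1)
G : ℕ → Set
G k = Fin k → Bool

compl : ∀ {k} → G k → G k
compl σ = not ∘ σ

bmul : Bool → ℤ → ℤ
bmul true  x = x
bmul false x = + 0

-- ξ_k(s0,s1), defined for k ≥ 1; index n stands for k = n+1.
-- ξ_{k+1}(σ, σ_{k+1}) = ξ_k(σ) + σ_{k+1} ξ_k(1-σ), the new coordinate being the LAST one.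
ξ : (n : ℕ) → ℤ → ℤ → G (suc n) → ℤ
ξ zero s₀ s₁ σ with σ F.zero
... | false = s₀
... | true  = s₁
ξ (suc n) s₀ s₁ σ =
  ξ n s₀ s₁ (σ ∘ inject₁) ℤ.+ bmul (σ (fromℕ (suc n))) (ξ n s₀ s₁ (compl (σ ∘ inject₁)))

-- division in ℚ of integers (denominator nonzero; convention x/0 = 0, never used
-- since the denominator here is a positive integer)
divℤ : ℤ → ℤ → ℚ
divℤ p (+ zero)    = 0ℚ
divℤ p (+ (suc n)) = p / suc n
divℤ p -[1+ n ]    = ℚ.- (p / suc n)

zeroσ : ∀ {k} → G k → G (suc k)
zeroσ σ = false ∷ σ

W : (k : ℕ) → G k → ℚ
W k σ = divℤ (ξ k (+ 1) (ℤ.- (+ 1)) (zeroσ σ)) (ξ k (+ 1) (+ 1) (zeroσ σ))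

dot : ∀ {k} → G k → G k → ℕ
dot {zero}  σ τ = 0
dot {suc k} σ τ = (if (σ F.zero ∧ τ F.zero) then 1 else 0) ℕ.+ dot (σ ∘ F.suc) (τ ∘ F.suc)

neg1^ : ℕ → ℚ
neg1^ zero    = 1ℚ
neg1^ (suc n) = ℚ.- neg1^ n

sumG : (k : ℕ) → (G k → ℚ) → ℚ
sumG zero    f = f (λ ())
sumG (suc k) f = sumG k (λ σ → f (false ∷ σ)) ℚ.+ sumG k (λ σ → f (true ∷ σ))

pow2inv : ℕ → ℚ
pow2inv zero    = 1ℚ
pow2inv (suc k) = (+ 1 / 2) ℚ.* pow2inv k

StrictlyFerromagnetic : (k : ℕ) → (G k → ℚ) → Set
StrictlyFerromagnetic k f =
  (τ : G k) → 0ℚ ℚ.≤ pow2inv k ℚ.* sumG k (λ σ → neg1^ (dot σ τ) ℚ.* f σ)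

{-# OPTIONS --safe #-}
module Submission where

-- Write x = W_k, w = W_{k+1} and s_b = (-1)^b. Since ξ is linear in (s₀,s₁), both are ratios of
-- linear forms in the same two integers, and clearing denominators gives
-- 3 w(b,σ) = s_b + x(σ) + s_b x(σ) w(b,σ). The Fourier transform on 𝔾_{k+1} turns the product
-- into a convolution, 3 ŵ(τ) = â(τ) + Σ_ρ ĝ(ρ) ŵ(τ+ρ) with a = s ⊗ 1 + 1 ⊗ x and g = s ⊗ x.
-- By induction x̂ ≥ 0, so â ≥ 0 and ĝ ≥ 0, and Σ_ρ ĝ(ρ) = g(0) = x(0) = 1. Evaluating at a
-- minimiser τ₀ of ŵ yields 3 ŵ(τ₀) ≥ ŵ(τ₀), hence ŵ ≥ 0.

open import Defs
open import Algebra.Bundles using (CommutativeMonoid)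
open import Data.Bool using (Bool; true; false; not; _∧_; _xor_)
open import Data.Bool.Properties using (not-distribˡ-xor; not-distribʳ-xor; not-involutive)
open import Data.Fin using (zero; suc; inject₁; fromℕ)
open import Data.Integer as ℤ using (ℤ; +_; -[1+_]; +[1+_]; +≤+)
import Data.Integer.Properties as ℤ
import Data.Integer.Tactic.RingSolver as ℤ-Solver
import Data.List as List
open import Data.Nat using (ℕ; zero; suc; z≤n; s≤s)
import Data.Nat.Properties as ℕ
open import Data.Product using (Σ-syntax; _,_)
open import Data.Rational as ℚ
  using (ℚ; 0ℚ; 1ℚ; ½; _+_; _*_; -_; _-_; _≤_; *≤*; NonZero; Positive; nonNegative; 1/_)
open import Data.Rational.Literals using (fromℤ)
open import Data.Rational.Properties
import Data.Rational.Unnormalised as ℚᵘ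
import Data.Rational.Unnormalised.Properties as ℚᵘ
open import Data.Sum using (inj₁; inj₂)
open import Data.Vec.Functional using (_∷_; head; tail)
open import Data.Vec.Functional.Properties using (∷-cong)
open import Function using (_∘_)
open import Relation.Binary.PropositionalEquality
open import Relation.Nullary.Decidable using (dec⇒maybe)
open import Tactic.RingSolver using (solve-∀; solve)
import Tactic.RingSolver.Core.AlmostCommutativeRing as ACR
open import Algebra.Properties.CommutativeSemigroup
  (CommutativeMonoid.commutativeSemigroup +-0-commutativeMonoid) renaming (interchange to +-interchange)

ℚ-ring : ACR.AlmostCommutativeRing _ _
ℚ-ring = ACR.fromCommutativeRing +-*-commutativeRing (λ q → dec⇒maybe (0ℚ ≟ q))

2ℚ : ℚ
2ℚ = + 2 ℚ./ 1

3ℚ : ℚ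
3ℚ = + 3 ℚ./ 1

0ᴳ : ∀ {k} → G k
0ᴳ _ = false

_⊕_ : ∀ {k} → G k → G k → G k
(σ ⊕ τ) i = σ i xor τ i

Extensional : ∀ {k} {A : Set} → (G k → A) → Set
Extensional {k} f = ∀ {σ σ' : G k} → σ ≗ σ' → f σ ≡ f σ'

∷-extensional : ∀ {k} {A : Set} {f : G (suc k) → A} b → Extensional f → Extensional (f ∘ (b ∷_))
∷-extensional b f-ext σ≗σ' = f-ext (∷-cong refl σ≗σ')

head∷tail≗ : ∀ {k} (σ : G (suc k)) → (head σ ∷ tail σ) ≗ σ
head∷tail≗ σ = ∷-cong refl (λ _ → refl)

≤-by-head : ∀ {k} {c} (h : G (suc k) → ℚ) → Extensional h →
  (∀ σ → c ≤ h (false ∷ σ)) → (∀ σ → c ≤ h (true ∷ σ)) → ∀ τ → c ≤ h τ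
≤-by-head {c = c} h h-ext c≤h₀ c≤h₁ τ = subst (c ≤_) (h-ext (head∷tail≗ τ)) (by-bit (head τ))
  where
  by-bit : ∀ b → c ≤ h (b ∷ tail τ)
  by-bit false = c≤h₀ (tail τ)
  by-bit true  = c≤h₁ (tail τ)

sumG-cong : ∀ k {f g : G k → ℚ} → f ≗ g → sumG k f ≡ sumG k g
sumG-cong zero    f≗g = f≗g _
sumG-cong (suc k) f≗g = cong₂ _+_ (sumG-cong k (f≗g ∘ (false ∷_))) (sumG-cong k (f≗g ∘ (true ∷_)))

sumG-+ : ∀ k (f g : G k → ℚ) → sumG k (λ σ → f σ + g σ) ≡ sumG k f + sumG k g
sumG-+ zero    f g = refl
sumG-+ (suc k) f g = trans (cong₂ _+_ (sumG-+ k f₀ g₀) (sumG-+ k f₁ g₁))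
  (+-interchange (sumG k f₀) (sumG k g₀) (sumG k f₁) (sumG k g₁))
  where
  f₀ f₁ g₀ g₁ : G k → ℚ
  f₀ = f ∘ (false ∷_)
  f₁ = f ∘ (true ∷_)
  g₀ = g ∘ (false ∷_)
  g₁ = g ∘ (true ∷_)

sumG-*ˡ : ∀ k c (f : G k → ℚ) → sumG k (λ σ → c * f σ) ≡ c * sumG k f
sumG-*ˡ zero    c f = refl
sumG-*ˡ (suc k) c f = trans (cong₂ _+_ (sumG-*ˡ k c _) (sumG-*ˡ k c _)) (sym (*-distribˡ-+ c _ _))

sumG-linear : ∀ k c d (f g : G k → ℚ) →
  sumG k (λ σ → c * f σ + d * g σ) ≡ c * sumG k f + d * sumG k g
sumG-linear k c d f g = trans (sumG-+ k _ _) (cong₂ _+_ (sumG-*ˡ k c f) (sumG-*ˡ k d g))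

sumG-mono-≤ : ∀ k {f g : G k → ℚ} → (∀ σ → f σ ≤ g σ) → sumG k f ≤ sumG k g
sumG-mono-≤ zero    f≤g = f≤g _
sumG-mono-≤ (suc k) f≤g = +-mono-≤ (sumG-mono-≤ k (f≤g ∘ (false ∷_))) (sumG-mono-≤ k (f≤g ∘ (true ∷_)))

≤-weighted-mean : ∀ k {μ} (p h : G k → ℚ) → (∀ ρ → 0ℚ ≤ p ρ) → sumG k p ≡ 1ℚ →
  (∀ ρ → μ ≤ h ρ) → μ ≤ sumG k (λ ρ → p ρ * h ρ)
≤-weighted-mean k {μ} p h p≥0 Σp≡1 μ≤h = begin
  μ                        ≡⟨ *-identityʳ μ ⟨
  μ * 1ℚ                   ≡⟨ cong (μ *_) Σp≡1 ⟨
  μ * sumG k p             ≡⟨ sumG-*ˡ k μ p ⟨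
  sumG k (λ ρ → μ * p ρ)   ≤⟨ sumG-mono-≤ k (λ ρ → μp≤ph ρ) ⟩
  sumG k (λ ρ → p ρ * h ρ) ∎
  where
  open ≤-Reasoning
  μp≤ph : ∀ ρ → μ * p ρ ≤ p ρ * h ρ
  μp≤ph ρ = ≤-trans (≤-reflexive (*-comm μ (p ρ))) (*-monoˡ-≤-nonNeg (p ρ) {{nonNegative (p≥0 ρ)}} (μ≤h ρ))

p≤[1+q]*p⇒0≤p : ∀ {p} q .{{_ : Positive q}} → p ≤ (1ℚ + q) * p → 0ℚ ≤ p
p≤[1+q]*p⇒0≤p {p} q p≤[1+q]p = *-cancelˡ-≤-pos q (begin
  q * 0ℚ               ≡⟨ *-zeroʳ q ⟩
  0ℚ                   ≡⟨ +-inverseʳ p ⟨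
  p - p                ≤⟨ +-monoˡ-≤ (- p) p≤[1+q]p ⟩
  (1ℚ + q) * p - p     ≡⟨ cancel p q ⟩
  q * p                ∎)
  where
  open ≤-Reasoning
  cancel : ∀ p q → (1ℚ + q) * p - p ≡ q * p
  cancel = solve-∀ ℚ-ring

0≤* : ∀ {p q} → 0ℚ ≤ p → 0ℚ ≤ q → 0ℚ ≤ p * q
0≤* {p} {q} 0≤p 0≤q = nonNegative⁻¹ (p * q)
  {{nonNeg*nonNeg⇒nonNeg p {{nonNegative 0≤p}} q {{nonNegative 0≤q}}}}

argmin : ∀ k (h : G k → ℚ) → Extensional h → Σ[ τ₀ ∈ G k ] (∀ τ → h τ₀ ≤ h τ)
argmin zero h h-ext = (λ ()) , λ τ → ≤-reflexive (h-ext (λ ()))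
argmin (suc k) h h-ext
  with argmin k (h ∘ (false ∷_)) (∷-extensional false h-ext)
     | argmin k (h ∘ (true ∷_)) (∷-extensional true h-ext)
... | τ₀ , min₀ | τ₁ , min₁ with ≤-total (h (false ∷ τ₀)) (h (true ∷ τ₁))
...   | inj₁ h₀≤h₁ = false ∷ τ₀ , ≤-by-head h h-ext min₀ (λ σ → ≤-trans h₀≤h₁ (min₁ σ))
...   | inj₂ h₁≤h₀ = true ∷ τ₁ , ≤-by-head h h-ext (λ σ → ≤-trans h₁≤h₀ (min₀ σ)) min₁

-- Evaluate the bound at a minimiser τ₀ of h: then h τ₀ ≤ (1 + q) h τ₀.
minimum-principle : ∀ k q .{{_ : Positive q}} (p h : G k → ℚ) → Extensional h →
  (∀ ρ → 0ℚ ≤ p ρ) → sumG k p ≡ 1ℚ →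
  (∀ τ → sumG k (λ ρ → p ρ * h (τ ⊕ ρ)) ≤ (1ℚ + q) * h τ) → ∀ τ → 0ℚ ≤ h τ
minimum-principle k q p h h-ext p≥0 Σp≡1 bound τ with argmin k h h-ext
... | τ₀ , min = ≤-trans (p≤[1+q]*p⇒0≤p q μ≤[1+q]μ) (min τ)
  where
  μ≤[1+q]μ : h τ₀ ≤ (1ℚ + q) * h τ₀
  μ≤[1+q]μ = ≤-trans
    (≤-weighted-mean k p (λ ρ → h (τ₀ ⊕ ρ)) p≥0 Σp≡1 (λ ρ → min (τ₀ ⊕ ρ))) (bound τ₀)

-- Characters and the Fourier transform on 𝔾_k

sgn : Bool → ℚ
sgn false = 1ℚ
sgn true  = - 1ℚ

sgn-xor : ∀ a b → sgn (a xor b) ≡ sgn a * sgn b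
sgn-xor false false = refl
sgn-xor false true  = refl
sgn-xor true  false = refl
sgn-xor true  true  = refl

fourier₁ : (Bool → ℚ) → Bool → ℚ
fourier₁ α c = ½ * (α false + sgn c * α true)

fourier₁-1≥0 : ∀ c → 0ℚ ≤ fourier₁ (λ _ → 1ℚ) c
fourier₁-1≥0 false = *≤* (+≤+ z≤n)
fourier₁-1≥0 true  = ≤-refl

fourier₁-sgn≥0 : ∀ c → 0ℚ ≤ fourier₁ sgn c
fourier₁-sgn≥0 false = ≤-refl
fourier₁-sgn≥0 true  = *≤* (+≤+ z≤n)

neg1^-dot : ∀ {k} (σ τ : G (suc k)) →
  neg1^ (dot σ τ) ≡ sgn (head σ ∧ head τ) * neg1^ (dot (tail σ) (tail τ))
neg1^-dot σ τ with σ zero ∧ τ zero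
... | false = sym (*-identityˡ _)
... | true  = trans (cong -_ (sym (*-identityˡ χ))) (neg-distribˡ-* 1ℚ χ)
  where χ = neg1^ (dot (tail σ) (tail τ))

dot-congʳ : ∀ {k} (σ : G k) {τ τ' : G k} → τ ≗ τ' → dot σ τ ≡ dot σ τ'
dot-congʳ {zero}  σ τ≗τ' = refl
dot-congʳ {suc k} σ τ≗τ' rewrite τ≗τ' zero | dot-congʳ (tail σ) (τ≗τ' ∘ suc) = refl

-- StrictlyFerromagnetic k f unfolds to ∀ τ → 0ℚ ≤ fourier k f τ.
fourier : ∀ k → (G k → ℚ) → G k → ℚ
fourier k f τ = pow2inv k * sumG k (λ σ → neg1^ (dot σ τ) * f σ)

fourier-cong : ∀ k {f g : G k → ℚ} → f ≗ g → ∀ τ → fourier k f τ ≡ fourier k g τ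
fourier-cong k f≗g τ = cong (pow2inv k *_) (sumG-cong k (λ σ → cong (neg1^ (dot σ τ) *_) (f≗g σ)))

fourier-extensional : ∀ k (f : G k → ℚ) → Extensional (fourier k f)
fourier-extensional k f τ≗τ' =
  cong (pow2inv k *_) (sumG-cong k (λ σ → cong (λ n → neg1^ n * f σ) (dot-congʳ σ τ≗τ')))

fourier-+ : ∀ k (f g : G k → ℚ) τ → fourier k (λ σ → f σ + g σ) τ ≡ fourier k f τ + fourier k g τ
fourier-+ k f g τ = trans
  (cong (pow2inv k *_) (trans (sumG-cong k (λ σ → *-distribˡ-+ (χ σ) (f σ) (g σ))) (sumG-+ k _ _)))
  (*-distribˡ-+ (pow2inv k) _ _)
  where χ = λ σ → neg1^ (dot σ τ)

fourier-*ˡ : ∀ k c (f : G k → ℚ) τ → fourier k (λ σ → c * f σ) τ ≡ c * fourier k f τ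
fourier-*ˡ k c f τ = trans
  (cong (pow2inv k *_) (trans (sumG-cong k (λ σ → x*[y*z]≡y*[x*z] (χ σ) c (f σ))) (sumG-*ˡ k c _)))
  (x*[y*z]≡y*[x*z] (pow2inv k) c (sumG k (λ σ → χ σ * f σ)))
  where
  χ = λ σ → neg1^ (dot σ τ)
  x*[y*z]≡y*[x*z] : ∀ x y z → x * (y * z) ≡ y * (x * z)
  x*[y*z]≡y*[x*z] = solve-∀ ℚ-ring

fourier-step : ∀ k (f : G (suc k) → ℚ) τ →
  fourier (suc k) f τ
    ≡ ½ * (fourier k (f ∘ (false ∷_)) (tail τ) + sgn (head τ) * fourier k (f ∘ (true ∷_)) (tail τ))
fourier-step k f τ = trans
  (cong (pow2inv (suc k) *_) (cong₂ _+_ (sum-over-bit false) (sum-over-bit true)))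
  (regroup (pow2inv k) (sgn (head τ)) (S false) (S true))
  where
  S : Bool → ℚ
  S b = sumG k (λ σ → neg1^ (dot σ (tail τ)) * f (b ∷ σ))
  sum-over-bit : ∀ b → sumG k (λ σ → neg1^ (dot (b ∷ σ) τ) * f (b ∷ σ)) ≡ sgn (b ∧ head τ) * S b
  sum-over-bit b = trans
    (sumG-cong k (λ σ → trans (cong (_* f (b ∷ σ)) (neg1^-dot (b ∷ σ) τ))
                              (*-assoc (sgn (b ∧ head τ)) (neg1^ (dot σ (tail τ))) (f (b ∷ σ)))))
    (sumG-*ˡ k (sgn (b ∧ head τ)) _)
  regroup : ∀ P s S₀ S₁ → (½ * P) * (1ℚ * S₀ + s * S₁) ≡ ½ * (P * S₀ + s * (P * S₁))
  regroup = solve-∀ ℚ-ring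

-- The characters of the first coordinate are orthogonal.
fourier-products-over-head : ∀ k (f g : G (suc k) → ℚ) τ ρ →
  fourier (suc k) f (false ∷ ρ) * fourier (suc k) g (τ ⊕ (false ∷ ρ))
    + fourier (suc k) f (true ∷ ρ) * fourier (suc k) g (τ ⊕ (true ∷ ρ))
  ≡ ½ * (fourier k (f ∘ (false ∷_)) ρ * fourier k (g ∘ (false ∷_)) (tail τ ⊕ ρ))
    + (½ * sgn (head τ)) * (fourier k (f ∘ (true ∷_)) ρ * fourier k (g ∘ (true ∷_)) (tail τ ⊕ ρ))
fourier-products-over-head k f g τ ρ = trans
  (cong₂ _+_ (cong₂ _*_ (fourier-step k f (false ∷ ρ)) (step-at false))
             (cong₂ _*_ (fourier-step k f (true ∷ ρ)) (step-at true)))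
  (orthogonality (f̂ false) (f̂ true) (ĝ false) (ĝ true) (sgn (head τ)))
  where
  f̂ ĝ : Bool → ℚ
  f̂ b = fourier k (f ∘ (b ∷_)) ρ
  ĝ b = fourier k (g ∘ (b ∷_)) (tail τ ⊕ ρ)
  step-at : ∀ c → fourier (suc k) g (τ ⊕ (c ∷ ρ)) ≡ ½ * (ĝ false + (sgn (head τ) * sgn c) * ĝ true)
  step-at c = trans (fourier-step k g (τ ⊕ (c ∷ ρ)))
    (cong (λ t → ½ * (ĝ false + t * ĝ true)) (sgn-xor (head τ) c))
  orthogonality : ∀ a₀ a₁ b₀ b₁ s →
    (½ * (a₀ + 1ℚ * a₁)) * (½ * (b₀ + (s * 1ℚ) * b₁))
      + (½ * (a₀ + - 1ℚ * a₁)) * (½ * (b₀ + (s * - 1ℚ) * b₁))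
    ≡ ½ * (a₀ * b₀) + (½ * s) * (a₁ * b₁)
  orthogonality = solve-∀ ℚ-ring

fourier-* : ∀ k (f g : G k → ℚ) τ →
  fourier k (λ σ → f σ * g σ) τ ≡ sumG k (λ ρ → fourier k f ρ * fourier k g (τ ⊕ ρ))
fourier-* zero    f g τ = unit-weights (f (λ ())) (g (λ ()))
  where
  unit-weights : ∀ a b → 1ℚ * (1ℚ * (a * b)) ≡ (1ℚ * (1ℚ * a)) * (1ℚ * (1ℚ * b))
  unit-weights = solve-∀ ℚ-ring
fourier-* (suc k) f g τ = begin
  fourier (suc k) (λ σ → f σ * g σ) τ
    ≡⟨ fourier-step k (λ σ → f σ * g σ) τ ⟩
  ½ * (fourier k (λ σ → f₀ σ * g₀ σ) τ' + s * fourier k (λ σ → f₁ σ * g₁ σ) τ')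
    ≡⟨ cong₂ (λ u v → ½ * (u + s * v)) (fourier-* k f₀ g₀ τ') (fourier-* k f₁ g₁ τ') ⟩
  ½ * (sumG k C₀ + s * sumG k C₁)
    ≡⟨ distrib ½ s (sumG k C₀) (sumG k C₁) ⟩
  ½ * sumG k C₀ + (½ * s) * sumG k C₁
    ≡⟨ sumG-linear k ½ (½ * s) C₀ C₁ ⟨
  sumG k (λ ρ → ½ * C₀ ρ + (½ * s) * C₁ ρ)
    ≡⟨ sumG-cong k (fourier-products-over-head k f g τ) ⟨
  sumG k (λ ρ → fourier (suc k) f (false ∷ ρ) * fourier (suc k) g (τ ⊕ (false ∷ ρ))
              + fourier (suc k) f (true ∷ ρ) * fourier (suc k) g (τ ⊕ (true ∷ ρ)))
    ≡⟨ sumG-+ k _ _ ⟩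
  sumG (suc k) (λ ρ → fourier (suc k) f ρ * fourier (suc k) g (τ ⊕ ρ))
    ∎
  where
  open ≡-Reasoning
  τ' = tail τ
  s = sgn (head τ)
  f₀ f₁ g₀ g₁ : G k → ℚ
  f₀ = f ∘ (false ∷_)
  f₁ = f ∘ (true ∷_)
  g₀ = g ∘ (false ∷_)
  g₁ = g ∘ (true ∷_)
  C₀ C₁ : G k → ℚ
  C₀ ρ = fourier k f₀ ρ * fourier k g₀ (τ' ⊕ ρ)
  C₁ ρ = fourier k f₁ ρ * fourier k g₁ (τ' ⊕ ρ)
  distrib : ∀ h s a b → h * (a + s * b) ≡ h * a + (h * s) * b
  distrib = solve-∀ ℚ-ring

sumG-fourier : ∀ k (f : G k → ℚ) → Extensional f → sumG k (fourier k f) ≡ f 0ᴳ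
sumG-fourier zero    f f-ext = trans (*-identityˡ _) (trans (*-identityˡ _) (f-ext (λ ())))
sumG-fourier (suc k) f f-ext = begin
  sumG k (λ ρ → fourier (suc k) f (false ∷ ρ)) + sumG k (λ ρ → fourier (suc k) f (true ∷ ρ))
    ≡⟨ cong₂ _+_ (sumG-cong k (fourier-step k f ∘ (false ∷_))) (sumG-cong k (fourier-step k f ∘ (true ∷_))) ⟩
  sumG k (λ ρ → ½ * (f̂₀ ρ + 1ℚ * f̂₁ ρ)) + sumG k (λ ρ → ½ * (f̂₀ ρ + - 1ℚ * f̂₁ ρ))
    ≡⟨ sumG-+ k _ _ ⟨
  sumG k (λ ρ → ½ * (f̂₀ ρ + 1ℚ * f̂₁ ρ) + ½ * (f̂₀ ρ + - 1ℚ * f̂₁ ρ))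
    ≡⟨ sumG-cong k (λ ρ → cancel (f̂₀ ρ) (f̂₁ ρ)) ⟩
  sumG k f̂₀
    ≡⟨ sumG-fourier k (f ∘ (false ∷_)) (∷-extensional false f-ext) ⟩
  f (false ∷ 0ᴳ)
    ≡⟨ f-ext (∷-cong refl (λ _ → refl)) ⟩
  f 0ᴳ
    ∎
  where
  open ≡-Reasoning
  f̂₀ f̂₁ : G k → ℚ
  f̂₀ = fourier k (f ∘ (false ∷_))
  f̂₁ = fourier k (f ∘ (true ∷_))
  cancel : ∀ a b → ½ * (a + 1ℚ * b) + ½ * (a + - 1ℚ * b) ≡ a
  cancel = solve-∀ ℚ-ring

fourier-⊗ : ∀ k (α : Bool → ℚ) (β : G k → ℚ) τ →
  fourier (suc k) (λ σ → α (head σ) * β (tail σ)) τ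
    ≡ fourier₁ α (head τ) * fourier k β (tail τ)
fourier-⊗ k α β τ = begin
  fourier (suc k) (λ σ → α (head σ) * β (tail σ)) τ
    ≡⟨ fourier-step k (λ σ → α (head σ) * β (tail σ)) τ ⟩
  ½ * (fourier k (λ σ → α false * β σ) (tail τ) + s * fourier k (λ σ → α true * β σ) (tail τ))
    ≡⟨ cong₂ (λ u v → ½ * (u + s * v)) (fourier-*ˡ k (α false) β (tail τ))
                                       (fourier-*ˡ k (α true) β (tail τ)) ⟩
  ½ * (α false * β̂ + s * (α true * β̂))
    ≡⟨ factor (α false) (α true) s β̂ ⟩
  (½ * (α false + s * α true)) * β̂
    ∎
  where
  open ≡-Reasoning
  s = sgn (head τ)
  β̂ = fourier k β (tail τ)
  factor : ∀ a₀ a₁ s b → ½ * (a₀ * b + s * (a₁ * b)) ≡ (½ * (a₀ + s * a₁)) * b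
  factor = solve-∀ ℚ-ring

fourier-fixed-point : ∀ k c (a g f : G k → ℚ) → (∀ σ → c * f σ ≡ a σ + g σ * f σ) →
  ∀ τ → c * fourier k f τ ≡ fourier k a τ + sumG k (λ ρ → fourier k g ρ * fourier k f (τ ⊕ ρ))
fourier-fixed-point k c a g f fixed τ = begin
  c * fourier k f τ                                     ≡⟨ fourier-*ˡ k c f τ ⟨
  fourier k (λ σ → c * f σ) τ                           ≡⟨ fourier-cong k fixed τ ⟩
  fourier k (λ σ → a σ + g σ * f σ) τ                   ≡⟨ fourier-+ k a (λ σ → g σ * f σ) τ ⟩
  fourier k a τ + fourier k (λ σ → g σ * f σ) τ         ≡⟨ cong (_+_ (fourier k a τ)) (fourier-* k g f τ) ⟩
  fourier k a τ + sumG k (λ ρ → fourier k g ρ * fourier k f (τ ⊕ ρ)) ∎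
  where open ≡-Reasoning

ferromagnetic-cong : ∀ k {f g : G k → ℚ} → f ≗ g → StrictlyFerromagnetic k f → StrictlyFerromagnetic k g
ferromagnetic-cong k f≗g f̂≥0 τ = subst (0ℚ ≤_) (fourier-cong k f≗g τ) (f̂≥0 τ)

ferromagnetic-+ : ∀ k {f g : G k → ℚ} →
  StrictlyFerromagnetic k f → StrictlyFerromagnetic k g → StrictlyFerromagnetic k (λ σ → f σ + g σ)
ferromagnetic-+ k {f} {g} f̂≥0 ĝ≥0 τ =
  subst (0ℚ ≤_) (sym (fourier-+ k f g τ)) (+-mono-≤ (f̂≥0 τ) (ĝ≥0 τ))

ferromagnetic-⊗ : ∀ k (α : Bool → ℚ) (β : G k → ℚ) → (∀ c → 0ℚ ≤ fourier₁ α c) →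
  StrictlyFerromagnetic k β → StrictlyFerromagnetic (suc k) (λ σ → α (head σ) * β (tail σ))
ferromagnetic-⊗ k α β α̂≥0 β̂≥0 τ =
  subst (0ℚ ≤_) (sym (fourier-⊗ k α β τ)) (0≤* (α̂≥0 (head τ)) (β̂≥0 (tail τ)))

ferromagnetic-1 : ∀ k → StrictlyFerromagnetic k (λ _ → 1ℚ)
ferromagnetic-1 zero    τ = *≤* (+≤+ z≤n)
ferromagnetic-1 (suc k) =
  ferromagnetic-⊗ k (λ _ → 1ℚ) (λ _ → 1ℚ) fourier₁-1≥0 (ferromagnetic-1 k)

ferromagnetic-head : ∀ k (α : Bool → ℚ) → (∀ c → 0ℚ ≤ fourier₁ α c) →
  StrictlyFerromagnetic (suc k) (λ σ → α (head σ))
ferromagnetic-head k α α̂≥0 = ferromagnetic-cong (suc k) (λ σ → *-identityʳ (α (head σ)))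
  (ferromagnetic-⊗ k α (λ _ → 1ℚ) α̂≥0 (ferromagnetic-1 k))

ferromagnetic-tail : ∀ k (β : G k → ℚ) → StrictlyFerromagnetic k β →
  StrictlyFerromagnetic (suc k) (λ σ → β (tail σ))
ferromagnetic-tail k β β̂≥0 = ferromagnetic-cong (suc k) (λ σ → *-identityˡ (β (tail σ)))
  (ferromagnetic-⊗ k (λ _ → 1ℚ) β fourier₁-1≥0 β̂≥0)

ferromagnetic-fixed-point : ∀ k q .{{_ : Positive q}} (a g f : G k → ℚ) → Extensional g →
  (∀ σ → (1ℚ + q) * f σ ≡ a σ + g σ * f σ) → g 0ᴳ ≡ 1ℚ →
  StrictlyFerromagnetic k a → StrictlyFerromagnetic k g → StrictlyFerromagnetic k f
ferromagnetic-fixed-point k q a g f g-ext fixed g0≡1 â≥0 ĝ≥0 =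
  minimum-principle k q (fourier k g) (fourier k f) (fourier-extensional k f) ĝ≥0
    (trans (sumG-fourier k g g-ext) g0≡1) averages≤
  where
  averages≤ : ∀ τ → sumG k (λ ρ → fourier k g ρ * fourier k f (τ ⊕ ρ)) ≤ (1ℚ + q) * fourier k f τ
  averages≤ τ = begin
    sumG k (λ ρ → fourier k g ρ * fourier k f (τ ⊕ ρ))
      ≡⟨ +-identityˡ _ ⟨
    0ℚ + sumG k (λ ρ → fourier k g ρ * fourier k f (τ ⊕ ρ))
      ≤⟨ +-monoˡ-≤ _ (â≥0 τ) ⟩
    fourier k a τ + sumG k (λ ρ → fourier k g ρ * fourier k f (τ ⊕ ρ))
      ≡⟨ fourier-fixed-point k (1ℚ + q) a g f fixed τ ⟨
    (1ℚ + q) * fourier k f τ ∎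
    where open ≤-Reasoning

-- The integers ξ_k(s₀,s₁)(σ)

not-xor-not : ∀ a b → not a xor not b ≡ a xor b
not-xor-not a b = begin
  not a xor not b     ≡⟨ not-distribˡ-xor a (not b) ⟨
  not (a xor not b)   ≡⟨ cong not (not-distribʳ-xor a b) ⟨
  not (not (a xor b)) ≡⟨ not-involutive (a xor b) ⟩
  a xor b             ∎
  where open ≡-Reasoning

bmul-linear : ∀ b s₀ s₁ x y → bmul b (s₀ ℤ.* x ℤ.+ s₁ ℤ.* y) ≡ s₀ ℤ.* bmul b x ℤ.+ s₁ ℤ.* bmul b y
bmul-linear true  s₀ s₁ x y = refl
bmul-linear false s₀ s₁ x y = zeros s₀ s₁
  where
  zeros : ∀ s₀ s₁ → + 0 ≡ s₀ ℤ.* + 0 ℤ.+ s₁ ℤ.* + 0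
  zeros = ℤ-Solver.solve-∀

bmul-nonNeg : ∀ b {x} → + 0 ℤ.≤ x → + 0 ℤ.≤ bmul b x
bmul-nonNeg true  0≤x = 0≤x
bmul-nonNeg false _   = ℤ.≤-refl

ξ-cong : ∀ n s₀ s₁ → Extensional (ξ n s₀ s₁)
ξ-cong zero    s₀ s₁ {σ} {σ'} σ≗σ' rewrite σ≗σ' zero = refl
ξ-cong (suc n) s₀ s₁ σ≗σ' = cong₂ ℤ._+_ (ξ-cong n s₀ s₁ (σ≗σ' ∘ inject₁))
  (cong₂ bmul (σ≗σ' (fromℕ (suc n))) (ξ-cong n s₀ s₁ (cong not ∘ σ≗σ' ∘ inject₁)))

ξ-merge : ∀ n s₀ s₁ a b (ρ : G n) →
  ξ (suc n) s₀ s₁ (a ∷ b ∷ ρ)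
    ≡ ξ n (s₀ ℤ.+ bmul (a xor b) s₁) (s₁ ℤ.+ bmul (not (a xor b)) s₀) (a ∷ ρ)
ξ-merge zero    s₀ s₁ false false ρ = refl
ξ-merge zero    s₀ s₁ false true  ρ = refl
ξ-merge zero    s₀ s₁ true  false ρ = refl
ξ-merge zero    s₀ s₁ true  true  ρ = refl
ξ-merge (suc n) s₀ s₁ a b ρ = begin
  ξ (suc n) s₀ s₁ ((a ∷ b ∷ ρ) ∘ inject₁) ℤ.+ bmul c (ξ (suc n) s₀ s₁ (compl ((a ∷ b ∷ ρ) ∘ inject₁)))
    ≡⟨ cong₂ (λ u v → u ℤ.+ bmul c v)
         (ξ-cong (suc n) s₀ s₁ restrict₂) (ξ-cong (suc n) s₀ s₁ restrict₂-compl) ⟩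
  ξ (suc n) s₀ s₁ (a ∷ b ∷ ρ') ℤ.+ bmul c (ξ (suc n) s₀ s₁ (not a ∷ not b ∷ compl ρ'))
    ≡⟨ cong₂ (λ u v → u ℤ.+ bmul c v) (ξ-merge n s₀ s₁ a b ρ') merge-compl ⟩
  ξ n t₀ t₁ (a ∷ ρ') ℤ.+ bmul c (ξ n t₀ t₁ (not a ∷ compl ρ'))
    ≡⟨ cong₂ (λ u v → u ℤ.+ bmul c v) (ξ-cong n t₀ t₁ restrict₁) (ξ-cong n t₀ t₁ restrict₁-compl) ⟩
  ξ (suc n) t₀ t₁ (a ∷ ρ)
    ∎
  where
  open ≡-Reasoning
  ρ' = ρ ∘ inject₁
  c = ρ (fromℕ n)
  merged₀ merged₁ : Bool → ℤ
  merged₀ x = s₀ ℤ.+ bmul x s₁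
  merged₁ x = s₁ ℤ.+ bmul (not x) s₀
  t₀ = merged₀ (a xor b)
  t₁ = merged₁ (a xor b)
  merge-compl : ξ (suc n) s₀ s₁ (not a ∷ not b ∷ compl ρ') ≡ ξ n t₀ t₁ (not a ∷ compl ρ')
  merge-compl = subst (λ x → ξ (suc n) s₀ s₁ (not a ∷ not b ∷ compl ρ')
                           ≡ ξ n (merged₀ x) (merged₁ x) (not a ∷ compl ρ'))
    (not-xor-not a b) (ξ-merge n s₀ s₁ (not a) (not b) (compl ρ'))
  restrict₂ : (a ∷ b ∷ ρ) ∘ inject₁ ≗ a ∷ b ∷ ρ'
  restrict₂ zero          = refl
  restrict₂ (suc zero)    = refl
  restrict₂ (suc (suc i)) = refl
  restrict₂-compl : compl ((a ∷ b ∷ ρ) ∘ inject₁) ≗ not a ∷ not b ∷ compl ρ'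
  restrict₂-compl zero          = refl
  restrict₂-compl (suc zero)    = refl
  restrict₂-compl (suc (suc i)) = refl
  restrict₁ : a ∷ ρ' ≗ (a ∷ ρ) ∘ inject₁
  restrict₁ zero    = refl
  restrict₁ (suc i) = refl
  restrict₁-compl : not a ∷ compl ρ' ≗ compl ((a ∷ ρ) ∘ inject₁)
  restrict₁-compl zero    = refl
  restrict₁-compl (suc i) = refl

ξ-extend : ∀ k s₀ s₁ (τ : G (suc k)) →
  ξ (suc k) s₀ s₁ (false ∷ τ)
    ≡ ξ k (s₀ ℤ.+ bmul (head τ) s₁) (s₁ ℤ.+ bmul (not (head τ)) s₀) (false ∷ tail τ)
ξ-extend k s₀ s₁ τ = trans
  (ξ-cong (suc k) s₀ s₁ {false ∷ τ} {false ∷ head τ ∷ tail τ} (∷-cong refl (sym ∘ head∷tail≗ τ)))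
  (ξ-merge k s₀ s₁ false (head τ) (tail τ))

ξ-linear : ∀ n s₀ s₁ σ → ξ n s₀ s₁ σ ≡ s₀ ℤ.* ξ n (+ 1) (+ 0) σ ℤ.+ s₁ ℤ.* ξ n (+ 0) (+ 1) σ
ξ-linear zero s₀ s₁ σ with σ zero
... | false = first s₀ s₁
  where
  first : ∀ s₀ s₁ → s₀ ≡ s₀ ℤ.* + 1 ℤ.+ s₁ ℤ.* + 0
  first = ℤ-Solver.solve-∀
... | true  = second s₀ s₁
  where
  second : ∀ s₀ s₁ → s₁ ≡ s₀ ℤ.* + 0 ℤ.+ s₁ ℤ.* + 1
  second = ℤ-Solver.solve-∀
ξ-linear (suc n) s₀ s₁ σ = begin
  ξ n s₀ s₁ σ' ℤ.+ bmul c (ξ n s₀ s₁ (compl σ'))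
    ≡⟨ cong₂ (λ u v → u ℤ.+ bmul c v) (ξ-linear n s₀ s₁ σ') (ξ-linear n s₀ s₁ (compl σ')) ⟩
  (s₀ ℤ.* A ℤ.+ s₁ ℤ.* B) ℤ.+ bmul c (s₀ ℤ.* A' ℤ.+ s₁ ℤ.* B')
    ≡⟨ cong (ℤ._+_ (s₀ ℤ.* A ℤ.+ s₁ ℤ.* B)) (bmul-linear c s₀ s₁ A' B') ⟩
  (s₀ ℤ.* A ℤ.+ s₁ ℤ.* B) ℤ.+ (s₀ ℤ.* bmul c A' ℤ.+ s₁ ℤ.* bmul c B')
    ≡⟨ regroup s₀ s₁ A B (bmul c A') (bmul c B') ⟩
  s₀ ℤ.* (A ℤ.+ bmul c A') ℤ.+ s₁ ℤ.* (B ℤ.+ bmul c B')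
    ∎
  where
  open ≡-Reasoning
  σ' = σ ∘ inject₁
  c = σ (fromℕ (suc n))
  A = ξ n (+ 1) (+ 0) σ'
  B = ξ n (+ 0) (+ 1) σ'
  A' = ξ n (+ 1) (+ 0) (compl σ')
  B' = ξ n (+ 0) (+ 1) (compl σ')
  regroup : ∀ s₀ s₁ a b a' b' →
    (s₀ ℤ.* a ℤ.+ s₁ ℤ.* b) ℤ.+ (s₀ ℤ.* a' ℤ.+ s₁ ℤ.* b')
      ≡ s₀ ℤ.* (a ℤ.+ a') ℤ.+ s₁ ℤ.* (b ℤ.+ b')
  regroup = ℤ-Solver.solve-∀

ξ-nonNeg : ∀ n {s₀ s₁} σ → + 0 ℤ.≤ s₀ → + 0 ℤ.≤ s₁ → + 0 ℤ.≤ ξ n s₀ s₁ σ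
ξ-nonNeg zero    σ 0≤s₀ 0≤s₁ with σ zero
... | false = 0≤s₀
... | true  = 0≤s₁
ξ-nonNeg (suc n) σ 0≤s₀ 0≤s₁ =
  ℤ.+-mono-≤ (ξ-nonNeg n _ 0≤s₀ 0≤s₁) (bmul-nonNeg _ (ξ-nonNeg n _ 0≤s₀ 0≤s₁))

ξ-positive : ∀ n {s₀ s₁} σ → head σ ≡ false → + 1 ℤ.≤ s₀ → + 0 ℤ.≤ s₁ → + 1 ℤ.≤ ξ n s₀ s₁ σ
ξ-positive zero    σ σ₀≡false 1≤s₀ 0≤s₁ rewrite σ₀≡false = 1≤s₀
ξ-positive (suc n) σ σ₀≡false 1≤s₀ 0≤s₁ = ℤ.≤-trans (ℤ.≤-reflexive (sym (ℤ.+-identityʳ (+ 1))))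
  (ℤ.+-mono-≤ (ξ-positive n (σ ∘ inject₁) σ₀≡false 1≤s₀ 0≤s₁)
              (bmul-nonNeg _ (ξ-nonNeg n _ (ℤ.≤-trans (+≤+ z≤n) 1≤s₀) 0≤s₁)))

ξ-0ᴳ : ∀ n s₀ s₁ → ξ n s₀ s₁ 0ᴳ ≡ s₀
ξ-0ᴳ zero    s₀ s₁ = refl
ξ-0ᴳ (suc n) s₀ s₁ = trans (ℤ.+-identityʳ _) (ξ-0ᴳ n s₀ s₁)

-- The recursion satisfied by W

fromℤ-+ : ∀ p q → fromℤ (p ℤ.+ q) ≡ fromℤ p + fromℤ q
fromℤ-+ p q = toℚᵘ-injective
  (ℚᵘ.≃-trans (ℚᵘ.*≡* (scale p q)) (ℚᵘ.≃-sym (toℚᵘ-homo-+ (fromℤ p) (fromℤ q))))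
  where
  scale : ∀ p q → (p ℤ.+ q) ℤ.* + 1 ≡ (p ℤ.* + 1 ℤ.+ q ℤ.* + 1) ℤ.* + 1
  scale = ℤ-Solver.solve-∀

fromℤ-* : ∀ p q → fromℤ (p ℤ.* q) ≡ fromℤ p * fromℤ q
fromℤ-* p q = toℚᵘ-injective (ℚᵘ.≃-sym (toℚᵘ-homo-* (fromℤ p) (fromℤ q)))

fromℤ-linear : ∀ c d p q → fromℤ (c ℤ.* p ℤ.+ d ℤ.* q) ≡ fromℤ c * fromℤ p + fromℤ d * fromℤ q
fromℤ-linear c d p q = trans (fromℤ-+ (c ℤ.* p) (d ℤ.* q)) (cong₂ _+_ (fromℤ-* c p) (fromℤ-* d q))

fromℤ-ξ : ∀ k s₀ s₁ σ →
  fromℤ (ξ k s₀ s₁ σ) ≡ fromℤ s₀ * fromℤ (ξ k (+ 1) (+ 0) σ) + fromℤ s₁ * fromℤ (ξ k (+ 0) (+ 1) σ)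
fromℤ-ξ k s₀ s₁ σ = trans (cong fromℤ (ξ-linear k s₀ s₁ σ)) (fromℤ-linear s₀ s₁ _ _)

fromℤ-nonZero : ∀ {q} → + 1 ℤ.≤ q → NonZero (fromℤ q)
fromℤ-nonZero {+[1+ n ]} _ = _
fromℤ-nonZero {+ 0} (+≤+ ())

divℤ-spec : ∀ p {q} → + 1 ℤ.≤ q → divℤ p q * fromℤ q ≡ fromℤ p
divℤ-spec p {+[1+ n ]} _ = toℚᵘ-injective (ℚᵘ.≃-trans (toℚᵘ-homo-* (p ℚ./ suc n) (fromℤ +[1+ n ]))
  (ℚᵘ.≃-trans (ℚᵘ.*-congʳ (toℚᵘ-fromℚᵘ (ℚᵘ.mkℚᵘ p n))) (ℚᵘ.*≡* cancel)))
  where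
  cancel : (p ℤ.* +[1+ n ]) ℤ.* + 1 ≡ p ℤ.* +[1+ n Data.Nat.* 1 ]
  cancel rewrite ℕ.*-identityʳ n = ℤ.*-identityʳ _
divℤ-spec p {+ 0} (+≤+ ())

*-cancelʳ-≡ : ∀ {p q} r .{{_ : NonZero r}} → p * r ≡ q * r → p ≡ q
*-cancelʳ-≡ {p} {q} r pr≡qr = begin
  p                ≡⟨ undo p ⟨
  (p * r) * 1/ r   ≡⟨ cong (_* 1/ r) pr≡qr ⟩
  (q * r) * 1/ r   ≡⟨ undo q ⟩
  q                ∎
  where
  open ≡-Reasoning
  undo : ∀ x → (x * r) * 1/ r ≡ x
  undo x = trans (*-assoc x r (1/ r)) (trans (cong (x *_) (*-inverseʳ r)) (*-identityʳ x))

clear-denominators : ∀ {s x w n₁ d₁ n₂ d₂ : ℚ} .{{_ : NonZero d₁}} .{{_ : NonZero d₂}} →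
  x * d₁ ≡ n₁ → w * d₂ ≡ n₂ → 3ℚ * n₂ * d₁ ≡ s * d₁ * d₂ + n₁ * d₂ + s * n₁ * n₂ →
  3ℚ * w ≡ s + x + s * x * w
clear-denominators {s} {x} {w} {d₁ = d₁} {d₂ = d₂} refl refl cleared =
  *-cancelʳ-≡ d₂ (*-cancelʳ-≡ d₁ (trans (lhs w d₁ d₂) (trans cleared (rhs s x w d₁ d₂))))
  where
  lhs : ∀ w d₁ d₂ → 3ℚ * w * d₂ * d₁ ≡ 3ℚ * (w * d₂) * d₁
  lhs = solve-∀ ℚ-ring
  rhs : ∀ s x w d₁ d₂ →
    s * d₁ * d₂ + x * d₁ * d₂ + s * (x * d₁) * (w * d₂) ≡ (s + x + s * x * w) * d₂ * d₁
  rhs = solve-∀ ℚ-ring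

W-cong : ∀ k → Extensional (W k)
W-cong k {σ} {σ'} σ≗σ' = cong₂ divℤ (ξ-cong k _ _ zeroσ≗) (ξ-cong k _ _ zeroσ≗)
  where
  zeroσ≗ : zeroσ σ ≗ zeroσ σ'
  zeroσ≗ = ∷-cong refl σ≗σ'

W-0ᴳ : ∀ k → W k 0ᴳ ≡ 1ℚ
W-0ᴳ k = cong₂ divℤ (trans (ξ-cong k _ _ zeroσ0≗0) (ξ-0ᴳ k _ _))
                    (trans (ξ-cong k _ _ zeroσ0≗0) (ξ-0ᴳ k _ _))
  where
  zeroσ0≗0 : zeroσ 0ᴳ ≗ 0ᴳ
  zeroσ0≗0 = ∷-cong refl (λ _ → refl)

-- With a = ξ_k(1,0)(0,σ) and b = ξ_k(0,1)(0,σ) one has W_k(σ) = (a - b)/(a + b),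
-- W_{k+1}(0,σ) = a/(a + 2b) and W_{k+1}(1,σ) = -b/(2a + b).
W-recursion : ∀ k (τ : G (suc k)) →
  3ℚ * W (suc k) τ ≡ sgn (head τ) + W k (tail τ) + sgn (head τ) * W k (tail τ) * W (suc k) τ
W-recursion k τ = clear-denominators {s = sgn (head τ)} {W k σ} {W (suc k) τ} {d₂ = fromℤ D₂}
  {{fromℤ-nonZero D₁≥1}} {{fromℤ-nonZero D₂≥1}} (divℤ-spec N₁ D₁≥1) (divℤ-spec N₂ D₂≥1)
  (polynomial (head τ) a b (in-ab (+ 1) -[1+ 0 ]) (in-ab (+ 1) (+ 1))
                           (in-ab′ (+ 1) -[1+ 0 ]) (in-ab′ (+ 1) (+ 1)))
  where
  σ = tail τ
  N₁ D₁ N₂ D₂ : ℤ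
  N₁ = ξ k (+ 1) -[1+ 0 ] (false ∷ σ)
  D₁ = ξ k (+ 1) (+ 1) (false ∷ σ)
  N₂ = ξ (suc k) (+ 1) -[1+ 0 ] (false ∷ τ)
  D₂ = ξ (suc k) (+ 1) (+ 1) (false ∷ τ)
  a b : ℚ
  a = fromℤ (ξ k (+ 1) (+ 0) (false ∷ σ))
  b = fromℤ (ξ k (+ 0) (+ 1) (false ∷ σ))
  D₁≥1 : + 1 ℤ.≤ D₁
  D₁≥1 = ξ-positive k (false ∷ σ) refl (+≤+ (s≤s z≤n)) (+≤+ z≤n)
  D₂≥1 : + 1 ℤ.≤ D₂
  D₂≥1 = ξ-positive (suc k) (false ∷ τ) refl (+≤+ (s≤s z≤n)) (+≤+ z≤n)
  in-ab : ∀ s₀ s₁ → fromℤ (ξ k s₀ s₁ (false ∷ σ)) ≡ fromℤ s₀ * a + fromℤ s₁ * b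
  in-ab s₀ s₁ = fromℤ-ξ k s₀ s₁ (false ∷ σ)
  in-ab′ : ∀ s₀ s₁ → fromℤ (ξ (suc k) s₀ s₁ (false ∷ τ))
    ≡ fromℤ (s₀ ℤ.+ bmul (head τ) s₁) * a + fromℤ (s₁ ℤ.+ bmul (not (head τ)) s₀) * b
  in-ab′ s₀ s₁ = trans (cong fromℤ (ξ-extend k s₀ s₁ τ)) (in-ab _ _)
  polynomial : ∀ c a b {n₁ d₁ n₂ d₂} →
    n₁ ≡ fromℤ (+ 1) * a + fromℤ -[1+ 0 ] * b → d₁ ≡ fromℤ (+ 1) * a + fromℤ (+ 1) * b →
    n₂ ≡ fromℤ (+ 1 ℤ.+ bmul c -[1+ 0 ]) * a + fromℤ (-[1+ 0 ] ℤ.+ bmul (not c) (+ 1)) * b →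
    d₂ ≡ fromℤ (+ 1 ℤ.+ bmul c (+ 1)) * a + fromℤ (+ 1 ℤ.+ bmul (not c) (+ 1)) * b →
    3ℚ * n₂ * d₁ ≡ sgn c * d₁ * d₂ + n₁ * d₂ + sgn c * n₁ * n₂
  polynomial false a b refl refl refl refl = solve (a List.∷ b List.∷ List.[]) ℚ-ring
  polynomial true  a b refl refl refl refl = solve (a List.∷ b List.∷ List.[]) ℚ-ring

lemma4p10 : (k : ℕ) → StrictlyFerromagnetic k (W k)
lemma4p10 zero    τ = *≤* (+≤+ z≤n)
lemma4p10 (suc k) = ferromagnetic-fixed-point (suc k) 2ℚ a g (W (suc k)) g-ext (W-recursion k) g0≡1 â≥0 ĝ≥0
  where
  a g : G (suc k) → ℚ
  a σ = sgn (head σ) + W k (tail σ)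
  g σ = sgn (head σ) * W k (tail σ)
  g-ext : Extensional g
  g-ext σ≗σ' = cong₂ (λ b y → sgn b * y) (σ≗σ' zero) (W-cong k (σ≗σ' ∘ suc))
  g0≡1 : g 0ᴳ ≡ 1ℚ
  g0≡1 = trans (*-identityˡ (W k 0ᴳ)) (W-0ᴳ k)
  â≥0 : StrictlyFerromagnetic (suc k) a
  â≥0 = ferromagnetic-+ (suc k) {λ σ → sgn (head σ)} {λ σ → W k (tail σ)}
    (ferromagnetic-head k sgn fourier₁-sgn≥0) (ferromagnetic-tail k (W k) (lemma4p10 k))
  ĝ≥0 : StrictlyFerromagnetic (suc k) g
  ĝ≥0 = ferromagnetic-⊗ k sgn (W k) fourier₁-sgn≥0 (lemma4p10 k)
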